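{- For $n>0$, the pre-column $2$-polygraph $\mathrm{PreCol}_2(n)$ is a presentation of the plactic monoid $\mathbf{P}_n$ (with $c_i$ corresponding to the generator $i$).
   Context: The plactic monoid $\mathbf{P}_n$ is the monoid generated by $[n]=\{1<\dots<n\}$ subject to $zxy=xzy$ for $1\le x\le y<z\le n$ and $yzx=yxz$ for $1\le x<y\le z\le n$. A column is a word $x_p\dots x_1$ over $[n]$ with $x_p>\dots>x_1$; $\mathrm{col}(n)$ is the set of nonempty columns. $\mathrm{PreCol}_2(n)$ is the $2$-polygraph with generators $c_u$, $u\in\mathrm{col}(n)$, and relations: $\alpha'_{x,zy}:c_xc_{zy}\Rightarrow c_{zx}c_y$ for $1\le x\le y<z\le n$; $\alpha'_{y,zx}:c_yc_{zx}\Rightarrow c_{yx}c_z$ for $1\le x<y\le z\le n$; and $\alpha'_{x,u}:c_xc_u\Rightarrow c_{xu}$ for every $x\in[n]$ and $u\in\mathrm{col}(n)$ such that $xu\in\mathrm{col}(n)$. A $2$-polygraph presents the quotient of the free monoid on its generators by the congruence generated by its relations. -}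

module Defs where

open import Data.Nat using (ℕ; _<ᵇ_)
open import Data.Bool using (Bool; true; false; _∧_; T)
open import Data.Fin using (Fin; toℕ; _≤_; _<_)
open import Data.List using (List; []; _∷_; _++_; concatMap)
open import Data.Product using (Σ; proj₁)
open import Relation.Binary.PropositionalEquality using (_≡_)
open import Relation.Binary.Construct.Closure.Equivalence using (EqClosure)

-- The alphabet [n] = {1 < ... < n} is represented by Fin n (letter i ↦ i-1),
-- ordered by the usual order on Fin n.

decreasing : {n : ℕ} → List (Fin n) → Bool
decreasing [] = true
decreasing (x ∷ []) = true
decreasing (x ∷ y ∷ r) = (toℕ y <ᵇ toℕ x) ∧ decreasing (y ∷ r)

isCol : {n : ℕ} → List (Fin n) → Bool
isCol [] = false
isCol (x ∷ r) = decreasing (x ∷ r)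

-- col(n): the set of nonempty columns (the proof component lives in T of a Bool,
-- so it is proof-irrelevant: one generator c_u per column u).
Col : ℕ → Set
Col n = Σ (List (Fin n)) (λ u → T (isCol u))

word : {n : ℕ} → Col n → List (Fin n)
word = proj₁

data Step {A : Set} (R : List A → List A → Set) : List A → List A → Set where
  step : ∀ u v l r → R l r → Step R (u ++ l ++ v) (u ++ r ++ v)

Congruence : {A : Set} → (List A → List A → Set) → List A → List A → Set
Congruence R = EqClosure (Step R)

data PlacticRule {n : ℕ} : List (Fin n) → List (Fin n) → Set where
  knuth₁ : (x y z : Fin n) → x ≤ y → y < z →
           PlacticRule (z ∷ x ∷ y ∷ []) (x ∷ z ∷ y ∷ [])
  knuth₂ : (x y z : Fin n) → x < y → y ≤ z →
           PlacticRule (y ∷ z ∷ x ∷ []) (y ∷ x ∷ z ∷ [])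

_≡plactic_ : {n : ℕ} → List (Fin n) → List (Fin n) → Set
_≡plactic_ = Congruence PlacticRule

data PreColRule {n : ℕ} : List (Col n) → List (Col n) → Set where
  α₁ : (x y z : Fin n) → x ≤ y → y < z →
       (cx czy czx cy : Col n) →
       word cx ≡ x ∷ [] → word czy ≡ z ∷ y ∷ [] →
       word czx ≡ z ∷ x ∷ [] → word cy ≡ y ∷ [] →
       PreColRule (cx ∷ czy ∷ []) (czx ∷ cy ∷ [])
  α₂ : (x y z : Fin n) → x < y → y ≤ z →
       (cy czx cyx cz : Col n) →
       word cy ≡ y ∷ [] → word czx ≡ z ∷ x ∷ [] →
       word cyx ≡ y ∷ x ∷ [] → word cz ≡ z ∷ [] →
       PreColRule (cy ∷ czx ∷ []) (cyx ∷ cz ∷ [])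
  α₃ : (x : Fin n) → (cx cu cxu : Col n) →
       word cx ≡ x ∷ [] → word cxu ≡ x ∷ word cu →
       PreColRule (cx ∷ cu ∷ []) (cxu ∷ [])

_≡precol_ : {n : ℕ} → List (Col n) → List (Col n) → Set
_≡precol_ = Congruence PreColRule

realize : {n : ℕ} → List (Col n) → List (Fin n)
realize = concatMap word

module Submission where

-- Let realize : c_u ↦ u be the monoid morphism from words over the
-- generators c_u to words over [n], and sings : i ↦ c_i the morphism in the
-- other direction.  The proof has three ingredients.
--   * A general transfer principle: a monoid morphism sending every rule of
--     one rewriting system into the congruence of another maps the whole
--     congruence generated by the first into that of the second.
--   * Soundness: realize sends each α'-relation to a Knuth relation or to a
--     trivial identity, so w ≡precol w′ implies realize w ≡plactic realize w′.
--   * Completeness: sings sends each Knuth relation to a zig-zag of three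
--     α'-relations (merging two letters into a column of length two), and
--     every column c_{x_p…x_1} is precol-equal to c_{x_p}…c_{x_1} (by
--     repeatedly splitting off the top letter with α'_{x,u}); hence every
--     word w is precol-equal to sings (realize w).
-- Injectivity follows by chaining these; surjectivity is witnessed by sings,
-- since realize ∘ sings is the identity.

open import Defs
open import Data.Nat using (ℕ; _≤_)
open import Data.List using (List)
open import Data.Fin using (Fin)
open import Data.Product using (_×_; ∃)
open import Function using (_⇔_)

open import Data.List using ([]; _∷_; _++_; map; concat)
open import Data.List.Properties
  using (++-assoc; ++-identityʳ; map-++; concat-++; concatMap-map; concatMap-pure)
open import Data.Product using (_,_; proj₂)
open import Data.Bool using (T)
open import Data.Bool.Properties using (T-∧)
open import Data.Unit using (tt)
open import Data.Nat.Properties using (<⇒<ᵇ; ≤-<-trans; <-≤-trans)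
open import Function using (mk⇔; Equivalence)
open import Relation.Binary.PropositionalEquality
  using (_≡_; refl; sym; trans; cong; subst; subst₂; module ≡-Reasoning)
open import Relation.Binary.Construct.Closure.ReflexiveTransitive using (ε; _◅_; _◅◅_)
open import Relation.Binary.Construct.Closure.Symmetric using (fwd)
open import Relation.Binary.Construct.Closure.Equivalence as EC using (gmap)

module CongruenceClosure {A : Set} (R : List A → List A → Set) where

  step-in-context : ∀ {a b} p q → Step R a b → Step R (p ++ a ++ q) (p ++ b ++ q)
  step-in-context p q (step u v l r rule) =
    subst₂ (Step R) (reassociate l) (reassociate r) (step (p ++ u) (v ++ q) l r rule)
    where
    reassociate : ∀ m → (p ++ u) ++ m ++ v ++ q ≡ p ++ (u ++ m ++ v) ++ q
    reassociate m = begin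
      (p ++ u) ++ m ++ v ++ q     ≡⟨ ++-assoc p u (m ++ v ++ q) ⟩
      p ++ u ++ m ++ v ++ q       ≡⟨ cong (λ t → p ++ u ++ t) (sym (++-assoc m v q)) ⟩
      p ++ u ++ (m ++ v) ++ q     ≡⟨ cong (p ++_) (sym (++-assoc u (m ++ v) q)) ⟩
      p ++ (u ++ m ++ v) ++ q     ∎
      where open ≡-Reasoning

  in-context : ∀ {a b} p q → Congruence R a b → Congruence R (p ++ a ++ q) (p ++ b ++ q)
  in-context p q = gmap (λ a → p ++ a ++ q) (step-in-context p q)

  rule : ∀ {l r} → R l r → Congruence R l r
  rule {l} {r} l⇒r =
    fwd (subst₂ (Step R) (++-identityʳ l) (++-identityʳ r) (step [] [] l r l⇒r)) ◅ ε

  symmetric : ∀ {a b} → Congruence R a b → Congruence R b a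
  symmetric = EC.symmetric (Step R)

  prefix : ∀ {a b} p → Congruence R a b → Congruence R (p ++ a) (p ++ b)
  prefix {a} {b} p a≡b =
    subst₂ (Congruence R) (cong (p ++_) (++-identityʳ a)) (cong (p ++_) (++-identityʳ b))
      (in-context p [] a≡b)

  append : ∀ {a a′ b b′} → Congruence R a a′ → Congruence R b b′ →
           Congruence R (a ++ b) (a′ ++ b′)
  append {b = b} a≡a′ b≡b′ = in-context [] b a≡a′ ◅◅ prefix _ b≡b′

open CongruenceClosure

module _ {A B : Set} {R : List A → List A → Set} {S : List B → List B → Set}
         (f : List A → List B) (f-++ : ∀ u v → f (u ++ v) ≡ f u ++ f v)
         (f-rule : ∀ {l r} → R l r → Congruence S (f l) (f r)) where

  morphism-preserves-congruence : ∀ {a b} → Congruence R a b → Congruence S (f a) (f b)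
  morphism-preserves-congruence =
    EC.gfold (EC.isEquivalence (Step S)) f step-image
    where
    f-context : ∀ u m v → f (u ++ m ++ v) ≡ f u ++ f m ++ f v
    f-context u m v = trans (f-++ u (m ++ v)) (cong (f u ++_) (f-++ m v))

    step-image : ∀ {a b} → Step R a b → Congruence S (f a) (f b)
    step-image (step u v l r l⇒r) =
      subst₂ (Congruence S) (sym (f-context u l v)) (sym (f-context u r v))
        (in-context S (f u) (f v) (f-rule l⇒r))

module _ {n : ℕ} where

  letter : Fin n → Col n
  letter x = (x ∷ [] , tt)

  letters : List (Fin n) → List (Col n)
  letters = map letter

  realize-++ : (a b : List (Col n)) → realize (a ++ b) ≡ realize a ++ realize b
  realize-++ a b = trans (cong concat (map-++ word a b)) (sym (concat-++ (map word a) (map word b)))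

  realize-letters : (v : List (Fin n)) → realize (letters v) ≡ v
  realize-letters v = trans (concatMap-map word letter v) (concatMap-pure v)

  realize-rule : ∀ {l r} → PreColRule {n} l r → realize l ≡plactic realize r
  realize-rule (α₁ x y z x≤y y<z cx czy czx cy refl refl refl refl) =
    symmetric PlacticRule (rule PlacticRule (knuth₁ x y z x≤y y<z))
  realize-rule (α₂ x y z x<y y≤z cy czx cyx cz refl refl refl refl) =
    rule PlacticRule (knuth₂ x y z x<y y≤z)
  realize-rule (α₃ x cx cu cxu refl word-cxu)
    rewrite word-cxu | ++-identityʳ (word cu) = ε

  realize-sound : ∀ {w w′} → w ≡precol w′ → realize w ≡plactic realize w′
  realize-sound = morphism-preserves-congruence realize realize-++ realize-rule

  column₂ : (z x : Fin n) → x Data.Fin.< z → Col n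
  column₂ z x x<z = (z ∷ x ∷ [] , Equivalence.from T-∧ (<⇒<ᵇ x<z , tt))

  merge : (z x : Fin n) (x<z : x Data.Fin.< z) →
          (letter z ∷ letter x ∷ []) ≡precol (column₂ z x x<z ∷ [])
  merge z x x<z = rule PreColRule (α₃ z (letter z) (letter x) (column₂ z x x<z) refl refl)

  -- Each Knuth relation holds between the corresponding words of letters:
  --   c_z c_x c_y ≡ c_{zx} c_y ≡ c_x c_{zy} ≡ c_x c_z c_y   (x ≤ y < z),
  --   c_y c_z c_x ≡ c_y c_{zx} ≡ c_{yx} c_z ≡ c_y c_x c_z   (x < y ≤ z).
  letters-rule : ∀ {l r} → PlacticRule {n} l r → letters l ≡precol letters r
  letters-rule (knuth₁ x y z x≤y y<z) =
    append PreColRule (merge z x x<z) ε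
    ◅◅ symmetric PreColRule (rule PreColRule
         (α₁ x y z x≤y y<z (letter x) (column₂ z y y<z) (column₂ z x x<z) (letter y)
             refl refl refl refl))
    ◅◅ symmetric PreColRule (prefix PreColRule (letter x ∷ []) (merge z y y<z))
    where x<z = ≤-<-trans x≤y y<z
  letters-rule (knuth₂ x y z x<y y≤z) =
    prefix PreColRule (letter y ∷ []) (merge z x x<z)
    ◅◅ rule PreColRule
         (α₂ x y z x<y y≤z (letter y) (column₂ z x x<z) (column₂ y x x<y) (letter z)
             refl refl refl refl)
    ◅◅ symmetric PreColRule (append PreColRule (merge y x x<y) ε)
    where x<z = <-≤-trans x<y y≤z

  letters-complete : ∀ {v v′} → v ≡plactic v′ → letters v ≡precol letters v′
  letters-complete = morphism-preserves-congruence letters (map-++ letter) letters-rule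

  -- A column c_{x_p…x_1} equals c_{x_p} … c_{x_1}: split off the top letter
  -- by α'_{x,u} and recurse on the remaining column (stated on the
  -- components of the column so that the recursion is structural).
  column-splits : (x : Fin n) (r : List (Fin n)) (decreasing-xr : T (decreasing (x ∷ r))) →
                  ((x ∷ r , decreasing-xr) ∷ []) ≡precol letters (x ∷ r)
  column-splits x [] _ = ε
  column-splits x (y ∷ r) decreasing-xyr =
    symmetric PreColRule (rule PreColRule
      (α₃ x (letter x) (y ∷ r , decreasing-yr) (x ∷ y ∷ r , decreasing-xyr) refl refl))
    ◅◅ prefix PreColRule (letter x ∷ []) (column-splits y r decreasing-yr)
    where decreasing-yr = proj₂ (Equivalence.to T-∧ decreasing-xyr)

  normalise-to-letters : (w : List (Col n)) → w ≡precol letters (realize w)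
  normalise-to-letters [] = ε
  normalise-to-letters (c@(x ∷ r , decreasing-xr) ∷ w) =
    subst (λ t → (c ∷ w) ≡precol t) (sym (map-++ letter (x ∷ r) (realize w)))
      (append PreColRule (column-splits x r decreasing-xr) (normalise-to-letters w))

proposition2p3p4 : (n : ℕ) → 1 ≤ n →
    ((w w′ : List (Col n)) → (w ≡precol w′) ⇔ (realize w ≡plactic realize w′))
    × ((v : List (Fin n)) → ∃ (λ w → v ≡plactic realize w))
proposition2p3p4 n _ = presentation , surjective
  where
  injective : (w w′ : List (Col n)) → realize w ≡plactic realize w′ → w ≡precol w′
  injective w w′ realizations-equal =
    normalise-to-letters w
    ◅◅ letters-complete realizations-equal
    ◅◅ symmetric PreColRule (normalise-to-letters w′)

  presentation : (w w′ : List (Col n)) → (w ≡precol w′) ⇔ (realize w ≡plactic realize w′)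
  presentation w w′ = mk⇔ realize-sound (injective w w′)

  surjective : (v : List (Fin n)) → ∃ (λ w → v ≡plactic realize w)
  surjective v = letters v , subst (v ≡plactic_) (sym (realize-letters v)) ε
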